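{- Let $q$ be a prime power, $\ell$ a prime with $\ell\nmid q$, $n\geq 1$, and $\nu=\mathrm{ord}_\ell(q-1)$ the $\ell$-adic valuation of $q-1$. Then every matrix over $\mathbb{Z}/\ell^n\mathbb{Z}$ of the form $\begin{pmatrix}1&w\\0&q\end{pmatrix}$ ($w\in\mathbb{Z}/\ell^n\mathbb{Z}$) is $\mathrm{GL}_2(\mathbb{Z}/\ell^n\mathbb{Z})$-conjugate to precisely one matrix of the set \[\Big\{M_a=\begin{pmatrix}1&\ell^a\\0&q\end{pmatrix} : 0\leq a\leq\nu\Big\}.\] -}

module Defs where

open import Data.Nat as ℕ using (ℕ; suc; _^_; _≥_; _∸_)
open import Data.Nat.Divisibility using (_∣_)
open import Data.Nat.Primality using (Prime)
open import Data.Integer as ℤ using (ℤ; +_; _-_)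
open import Data.Integer.Divisibility as ℤD using ()
open import Data.Product using (Σ; ∃; _×_; _,_)
open import Relation.Nullary using (¬_)
open import Relation.Binary.PropositionalEquality using (_≡_)

IsPrimePower : ℕ → Set
IsPrimePower q = Σ ℕ λ p → Σ ℕ λ k → Prime p × k ≥ 1 × q ≡ p ^ k

IsValuation : ℕ → ℕ → ℕ → Set
IsValuation ℓ m ν = (ℓ ^ ν) ∣ m × ¬ ((ℓ ^ suc ν) ∣ m)

infix 4 _≡[mod_]_
_≡[mod_]_ : ℤ → ℕ → ℤ → Set
x ≡[mod N ] y = (+ N) ℤD.∣ (x - y)

record Mat2 : Set where
  constructor mat
  field a b c d : ℤ
open Mat2 public

_⊗_ : Mat2 → Mat2 → Mat2
mat a₁ b₁ c₁ d₁ ⊗ mat a₂ b₂ c₂ d₂ =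
  mat (a₁ ℤ.* a₂ ℤ.+ b₁ ℤ.* c₂) (a₁ ℤ.* b₂ ℤ.+ b₁ ℤ.* d₂)
      (c₁ ℤ.* a₂ ℤ.+ d₁ ℤ.* c₂) (c₁ ℤ.* b₂ ℤ.+ d₁ ℤ.* d₂)
infixl 7 _⊗_

I₂ : Mat2
I₂ = mat (+ 1) (+ 0) (+ 0) (+ 1)

infix 4 _≅[mod_]_
_≅[mod_]_ : Mat2 → ℕ → Mat2 → Set
A ≅[mod N ] B = (a A ≡[mod N ] a B) × (b A ≡[mod N ] b B)
              × (c A ≡[mod N ] c B) × (d A ≡[mod N ] d B)

Conj : ℕ → Mat2 → Mat2 → Set
Conj N A B = Σ Mat2 λ P → Σ Mat2 λ Q →
  (P ⊗ Q ≅[mod N ] I₂) × (Q ⊗ P ≅[mod N ] I₂) × (P ⊗ A ⊗ Q ≅[mod N ] B)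

Up : ℤ → ℕ → Mat2
Up w q = mat (+ 1) w (+ 0) (+ q)

M : ℕ → ℕ → ℕ → Mat2
M ℓ q α = Up (+ (ℓ ^ α)) q

module Submission where

-- Conjugating ( 1 w ; 0 q ) by ( s y ; 0 1 ), with s a unit modulo
-- ℓ^n, gives ( 1 sw+y(q−1) ; 0 q ).  Let a ≤ ν be maximal with ℓ^a ∣ w, say
-- w = k ℓ^a.  If ℓ ∤ k, take s = k⁻¹ and y = 0 to reach M_a; otherwise a = ν,
-- q − 1 = u ℓ^ν with ℓ ∤ u, and s = 1, y = u⁻¹(1 − k) reaches M_ν.  Units
-- modulo ℓ^n come from Bézout, since ℓ^n is coprime to anything ℓ does not divide.
--
-- For D ∣ N, being ≡ I (mod D) is invariant under conjugation
-- modulo N, and M_α ≡ I (mod ℓ^c) iff c ≤ α (for c ≤ ν).  Hence two matrices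
-- M_α, M_β in the class satisfy min(n,α) = min(n,β), so ℓ^α ≡ ℓ^β (mod ℓ^n).

open import Defs
open import Data.Nat using (ℕ; _^_; _≤_; _≥_; _∸_)
open import Data.Nat.Divisibility using (_∣_)
open import Data.Nat.Primality using (Prime)
open import Data.Integer using (ℤ)
open import Data.Product using (Σ; _×_)
open import Relation.Nullary using (¬_)

open import Data.Nat as ℕ using (zero; suc; _<_; nonTrivial⇒n>1)
open import Relation.Nullary using (Dec; yes; no)
import Data.Nat.Properties as ℕ
import Data.Nat.Divisibility as ℕ∣
open import Data.Nat.Coprimality using (Coprime; coprime-divisor; coprime-Bézout)
open import Data.Nat.GCD using (module Bézout)
open import Data.Nat.Primality using (prime⇒irreducible; prime⇒nonTrivial)
open import Data.Integer using (+_; -_; -[1+_]; _+_; _-_; _*_; ∣_∣)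
import Data.Integer.Properties as ℤ
open import Data.Integer.Divisibility.Signed as ℤ∣ using (divides) renaming (_∣_ to _∣ℤ_)
open import Data.Integer.Tactic.RingSolver using (solve-∀)
open import Data.Product using (_,_)
open import Data.Sum using (_⊎_; inj₁; inj₂)
open import Data.Empty using (⊥-elim)
open import Level using (0ℓ)
open import Relation.Binary.Bundles using (Setoid)
open import Relation.Binary.PropositionalEquality
  using (_≡_; refl; sym; trans; cong; cong₂; subst; subst₂; module ≡-Reasoning)
import Relation.Binary.Reasoning.Setoid as SetoidReasoning

-- Congruence of integers modulo N, phrased with signed divisibility (which has
-- the convenient algebra) and wrapped in a record so that x and y are inferable.
infix 4 _≈_[mod_]
record _≈_[mod_] (x y : ℤ) (N : ℕ) : Set where
  constructor ≈-intro
  field divisible : + N ∣ℤ x - y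
open _≈_[mod_]

module _ {N : ℕ} where

  ≈-reflexive : ∀ {x y} → x ≡ y → x ≈ y [mod N ]
  ≈-reflexive {x} refl = ≈-intro (divides (+ 0) (ℤ.+-inverseʳ x))

  ≈-refl : ∀ {x} → x ≈ x [mod N ]
  ≈-refl = ≈-reflexive refl

  private
    along : ∀ {u v} → u ≡ v → + N ∣ℤ u → + N ∣ℤ v
    along = subst (+ N ∣ℤ_)

  ≈-sym : ∀ {x y} → x ≈ y [mod N ] → y ≈ x [mod N ]
  ≈-sym {x} {y} (≈-intro n∣x-y) = ≈-intro (along (negate x y) (ℤ∣.∣m⇒∣-m n∣x-y))
    where negate : ∀ x y → - (x - y) ≡ y - x
          negate = solve-∀

  ≈-trans : ∀ {x y z} → x ≈ y [mod N ] → y ≈ z [mod N ] → x ≈ z [mod N ]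
  ≈-trans {x} {y} {z} (≈-intro n∣x-y) (≈-intro n∣y-z) =
    ≈-intro (along (telescope x y z) (ℤ∣.∣m∣n⇒∣m+n n∣x-y n∣y-z))
    where telescope : ∀ x y z → (x - y) + (y - z) ≡ x - z
          telescope = solve-∀

  +-cong : ∀ {x x′ y y′} → x ≈ x′ [mod N ] → y ≈ y′ [mod N ] → x + y ≈ x′ + y′ [mod N ]
  +-cong {x} {x′} {y} {y′} (≈-intro n∣dx) (≈-intro n∣dy) =
    ≈-intro (along (split x x′ y y′) (ℤ∣.∣m∣n⇒∣m+n n∣dx n∣dy))
    where split : ∀ x x′ y y′ → (x - x′) + (y - y′) ≡ (x + y) - (x′ + y′)
          split = solve-∀

  *-cong : ∀ {x x′ y y′} → x ≈ x′ [mod N ] → y ≈ y′ [mod N ] → x * y ≈ x′ * y′ [mod N ]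
  *-cong {x} {x′} {y} {y′} (≈-intro n∣dx) (≈-intro n∣dy) =
    ≈-intro (along (split x x′ y y′) (ℤ∣.∣m∣n⇒∣m+n (ℤ∣.∣m⇒∣m*n y n∣dx) (ℤ∣.∣n⇒∣m*n x′ n∣dy)))
    where split : ∀ x x′ y y′ → (x - x′) * y + x′ * (y - y′) ≡ x * y - x′ * y′
          split = solve-∀

≈-weaken : ∀ {D N x y} → D ∣ N → x ≈ y [mod N ] → x ≈ y [mod D ]
≈-weaken D∣N (≈-intro n∣d) = ≈-intro (ℤ∣.∣-trans (ℤ∣.∣ᵤ⇒∣ D∣N) n∣d)

≈-multiple : ∀ {N x y u v} k → x - y ≡ (u - v) * k → u ≈ v [mod N ] → x ≈ y [mod N ]
≈-multiple {N} k eq (≈-intro n∣u-v) =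
  ≈-intro (subst (+ N ∣ℤ_) (sym eq) (ℤ∣.∣m⇒∣m*n k n∣u-v))

infix 4 _≈ₘ_[mod_]
record _≈ₘ_[mod_] (A B : Mat2) (N : ℕ) : Set where
  constructor ≈ₘ-intro
  field
    a≈ : a A ≈ a B [mod N ]
    b≈ : b A ≈ b B [mod N ]
    c≈ : c A ≈ c B [mod N ]
    d≈ : d A ≈ d B [mod N ]
open _≈ₘ_[mod_]

fromCong : ∀ {N A B} → A ≅[mod N ] B → A ≈ₘ B [mod N ]
fromCong (a≅ , b≅ , c≅ , d≅) =
  ≈ₘ-intro (≈-intro (ℤ∣.∣ᵤ⇒∣ a≅)) (≈-intro (ℤ∣.∣ᵤ⇒∣ b≅))
           (≈-intro (ℤ∣.∣ᵤ⇒∣ c≅)) (≈-intro (ℤ∣.∣ᵤ⇒∣ d≅))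

toCong : ∀ {N A B} → A ≈ₘ B [mod N ] → A ≅[mod N ] B
toCong (≈ₘ-intro a≈ b≈ c≈ d≈) =
  ℤ∣.∣⇒∣ᵤ (divisible a≈) , ℤ∣.∣⇒∣ᵤ (divisible b≈) ,
  ℤ∣.∣⇒∣ᵤ (divisible c≈) , ℤ∣.∣⇒∣ᵤ (divisible d≈)

module _ {N : ℕ} where

  ≈ₘ-reflexive : ∀ {A B} → A ≡ B → A ≈ₘ B [mod N ]
  ≈ₘ-reflexive refl = ≈ₘ-intro ≈-refl ≈-refl ≈-refl ≈-refl

  ≈ₘ-sym : ∀ {A B} → A ≈ₘ B [mod N ] → B ≈ₘ A [mod N ]
  ≈ₘ-sym (≈ₘ-intro a≈ b≈ c≈ d≈) = ≈ₘ-intro (≈-sym a≈) (≈-sym b≈) (≈-sym c≈) (≈-sym d≈)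

  ≈ₘ-trans : ∀ {A B C} → A ≈ₘ B [mod N ] → B ≈ₘ C [mod N ] → A ≈ₘ C [mod N ]
  ≈ₘ-trans (≈ₘ-intro a₁ b₁ c₁ d₁) (≈ₘ-intro a₂ b₂ c₂ d₂) =
    ≈ₘ-intro (≈-trans a₁ a₂) (≈-trans b₁ b₂) (≈-trans c₁ c₂) (≈-trans d₁ d₂)

  Mat2-mod : Setoid 0ℓ 0ℓ
  Mat2-mod = record
    { Carrier = Mat2
    ; _≈_ = _≈ₘ_[mod N ]
    ; isEquivalence = record { refl = ≈ₘ-reflexive refl ; sym = ≈ₘ-sym ; trans = ≈ₘ-trans } }

  ⊗-cong : ∀ {A A′ B B′} → A ≈ₘ A′ [mod N ] → B ≈ₘ B′ [mod N ] → A ⊗ B ≈ₘ A′ ⊗ B′ [mod N ]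
  ⊗-cong {mat _ _ _ _} {mat _ _ _ _} {mat _ _ _ _} {mat _ _ _ _}
         (≈ₘ-intro a₁ b₁ c₁ d₁) (≈ₘ-intro a₂ b₂ c₂ d₂) =
    ≈ₘ-intro (dot a₁ b₁ a₂ c₂) (dot a₁ b₁ b₂ d₂) (dot c₁ d₁ a₂ c₂) (dot c₁ d₁ b₂ d₂)
    where
    dot : ∀ {x x′ y y′ u u′ v v′} → x ≈ x′ [mod N ] → y ≈ y′ [mod N ]
        → u ≈ u′ [mod N ] → v ≈ v′ [mod N ] → x * u + y * v ≈ x′ * u′ + y′ * v′ [mod N ]
    dot x≈ y≈ u≈ v≈ = +-cong (*-cong x≈ u≈) (*-cong y≈ v≈)

  ⊗-congˡ : ∀ C {A B} → A ≈ₘ B [mod N ] → C ⊗ A ≈ₘ C ⊗ B [mod N ]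
  ⊗-congˡ C = ⊗-cong (≈ₘ-reflexive {C} refl)

  ⊗-congʳ : ∀ C {A B} → A ≈ₘ B [mod N ] → A ⊗ C ≈ₘ B ⊗ C [mod N ]
  ⊗-congʳ C A≈B = ⊗-cong A≈B (≈ₘ-reflexive {C} refl)

≈ₘ-weaken : ∀ {D N A B} → D ∣ N → A ≈ₘ B [mod N ] → A ≈ₘ B [mod D ]
≈ₘ-weaken D∣N (≈ₘ-intro a≈ b≈ c≈ d≈) =
  ≈ₘ-intro (≈-weaken D∣N a≈) (≈-weaken D∣N b≈) (≈-weaken D∣N c≈) (≈-weaken D∣N d≈)

mat-≡ : ∀ {a b c d a′ b′ c′ d′} → a ≡ a′ → b ≡ b′ → c ≡ c′ → d ≡ d′
      → mat a b c d ≡ mat a′ b′ c′ d′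
mat-≡ refl refl refl refl = refl

⊗-assoc : ∀ A B C → A ⊗ B ⊗ C ≡ A ⊗ (B ⊗ C)
⊗-assoc (mat a₁ b₁ c₁ d₁) (mat a₂ b₂ c₂ d₂) (mat a₃ b₃ c₃ d₃) =
  mat-≡ (entry a₁ b₁ a₂ b₂ c₂ d₂ a₃ c₃) (entry a₁ b₁ a₂ b₂ c₂ d₂ b₃ d₃)
        (entry c₁ d₁ a₂ b₂ c₂ d₂ a₃ c₃) (entry c₁ d₁ a₂ b₂ c₂ d₂ b₃ d₃)
  where
  entry : ∀ x y a₂ b₂ c₂ d₂ u v →
          (x * a₂ + y * c₂) * u + (x * b₂ + y * d₂) * v
          ≡ x * (a₂ * u + b₂ * v) + y * (c₂ * u + d₂ * v)
  entry = solve-∀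

⊗-identityˡ : ∀ A → I₂ ⊗ A ≡ A
⊗-identityˡ (mat a b c d) = mat-≡ (top a c) (top b d) (bottom a c) (bottom b d)
  where
  top : ∀ x y → + 1 * x + + 0 * y ≡ x
  top = solve-∀
  bottom : ∀ x y → + 0 * x + + 1 * y ≡ y
  bottom = solve-∀

⊗-identityʳ : ∀ A → A ⊗ I₂ ≡ A
⊗-identityʳ (mat a b c d) = mat-≡ (left a b) (right a b) (left c d) (right c d)
  where
  left : ∀ x y → x * + 1 + y * + 0 ≡ x
  left = solve-∀
  right : ∀ x y → x * + 0 + y * + 1 ≡ y
  right = solve-∀

⊗-sandwich : ∀ Q P A → Q ⊗ (P ⊗ A ⊗ Q) ⊗ P ≡ Q ⊗ P ⊗ A ⊗ (Q ⊗ P)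
⊗-sandwich Q P A = begin
  Q ⊗ (P ⊗ A ⊗ Q) ⊗ P   ≡⟨ cong (_⊗ P) (⊗-assoc Q (P ⊗ A) Q) ⟨
  Q ⊗ (P ⊗ A) ⊗ Q ⊗ P   ≡⟨ cong (λ X → X ⊗ Q ⊗ P) (⊗-assoc Q P A) ⟨
  Q ⊗ P ⊗ A ⊗ Q ⊗ P     ≡⟨ ⊗-assoc (Q ⊗ P ⊗ A) Q P ⟩
  Q ⊗ P ⊗ A ⊗ (Q ⊗ P)   ∎
  where open ≡-Reasoning

Conj-sym : ∀ {N A B} → Conj N A B → Conj N B A
Conj-sym {N} {A} {B} (P , Q , PQ≅I , QP≅I , PAQ≅B) = Q , P , QP≅I , PQ≅I , toCong QBP≈A
  where
  open SetoidReasoning (Mat2-mod {N})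
  QP≈I : Q ⊗ P ≈ₘ I₂ [mod N ]
  QP≈I = fromCong QP≅I
  PAQ≈B : P ⊗ A ⊗ Q ≈ₘ B [mod N ]
  PAQ≈B = fromCong PAQ≅B
  QBP≈A : Q ⊗ B ⊗ P ≈ₘ A [mod N ]
  QBP≈A = begin
    Q ⊗ B ⊗ P               ≈⟨ ⊗-congʳ P (⊗-congˡ Q PAQ≈B) ⟨
    Q ⊗ (P ⊗ A ⊗ Q) ⊗ P     ≡⟨ ⊗-sandwich Q P A ⟩
    Q ⊗ P ⊗ A ⊗ (Q ⊗ P)     ≈⟨ ⊗-cong (⊗-congʳ A QP≈I) QP≈I ⟩
    I₂ ⊗ A ⊗ I₂             ≡⟨ cong (_⊗ I₂) (⊗-identityˡ A) ⟩
    A ⊗ I₂                  ≡⟨ ⊗-identityʳ A ⟩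
    A                       ∎

≡I-invariant : ∀ {D N A B} → D ∣ N → Conj N A B → A ≈ₘ I₂ [mod D ] → B ≈ₘ I₂ [mod D ]
≡I-invariant {D} {N} {A} {B} D∣N (P , Q , PQ≅I , _ , PAQ≅B) A≈I = begin
  B               ≈⟨ ≈ₘ-weaken D∣N PAQ≈B ⟨
  P ⊗ A ⊗ Q       ≈⟨ ⊗-congʳ Q (⊗-congˡ P A≈I) ⟩
  P ⊗ I₂ ⊗ Q      ≡⟨ cong (_⊗ Q) (⊗-identityʳ P) ⟩
  P ⊗ Q           ≈⟨ ≈ₘ-weaken D∣N PQ≈I ⟩
  I₂              ∎
  where
  open SetoidReasoning (Mat2-mod {D})
  PQ≈I : P ⊗ Q ≈ₘ I₂ [mod N ]
  PQ≈I = fromCong PQ≅I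
  PAQ≈B : P ⊗ A ⊗ Q ≈ₘ B [mod N ]
  PAQ≈B = fromCong PAQ≅B

Conj-respʳ : ∀ {N A B B′} → Conj N A B → B ≈ₘ B′ [mod N ] → Conj N A B′
Conj-respʳ {N} {A} {B} (P , Q , PQ≅I , QP≅I , PAQ≅B) B≈B′ =
  P , Q , PQ≅I , QP≅I , toCong (≈ₘ-trans (fromCong {N} {P ⊗ A ⊗ Q} {B} PAQ≅B) B≈B′)

Up-cong : ∀ {N w w′ q} → w ≈ w′ [mod N ] → Up w q ≈ₘ Up w′ q [mod N ]
Up-cong w≈w′ = ≈ₘ-intro ≈-refl w≈w′ ≈-refl ≈-refl

triangular-conj : ∀ {N} s t y w q → t * s ≈ + 1 [mod N ]
                → Conj N (Up w q) (Up (s * w + y * (+ q - + 1)) q)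
triangular-conj {N} s t y w q ts≈1 =
  P , Q ,
  toCong {A = P ⊗ Q} {B = I₂}
         (≈ₘ-intro (≈-multiple (+ 1) (PQ-a s t y) ts≈1) (≈-multiple (- y) (PQ-b s t y) ts≈1)
                   (≈-reflexive (zero-row t)) (≈-reflexive (one-row (- (t * y))))) ,
  toCong {A = Q ⊗ P} {B = I₂}
         (≈ₘ-intro (≈-multiple (+ 1) (QP-a s t y) ts≈1) (≈-reflexive (QP-b t y))
                   (≈-reflexive (zero-row s)) (≈-reflexive (one-row y))) ,
  toCong {A = P ⊗ Up w q ⊗ Q}
         (≈ₘ-intro (≈-multiple (+ 1) (PAQ-a s t y w (+ q)) ts≈1)
                   (≈-multiple (- y) (PAQ-b s t y w (+ q)) ts≈1)
                   (≈-reflexive (PAQ-c t w (+ q))) (≈-reflexive (PAQ-d t y w (+ q))))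
  where
  P Q : Mat2
  P = mat s y (+ 0) (+ 1)
  Q = mat t (- (t * y)) (+ 0) (+ 1)
  PQ-a : ∀ s t y → (s * t + y * + 0) - + 1 ≡ (t * s - + 1) * + 1
  PQ-a = solve-∀
  PQ-b : ∀ s t y → (s * (- (t * y)) + y * + 1) - + 0 ≡ (t * s - + 1) * (- y)
  PQ-b = solve-∀
  QP-a : ∀ s t y → (t * s + (- (t * y)) * + 0) - + 1 ≡ (t * s - + 1) * + 1
  QP-a = solve-∀
  QP-b : ∀ t y → t * y + (- (t * y)) * + 1 ≡ + 0
  QP-b = solve-∀
  zero-row : ∀ x → + 0 * x + + 1 * + 0 ≡ + 0
  zero-row = solve-∀
  one-row : ∀ x → + 0 * x + + 1 * + 1 ≡ + 1
  one-row = solve-∀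
  PAQ-a : ∀ s t y w q → ((s * + 1 + y * + 0) * t + (s * w + y * q) * + 0) - + 1
                        ≡ (t * s - + 1) * + 1
  PAQ-a = solve-∀
  PAQ-b : ∀ s t y w q → ((s * + 1 + y * + 0) * (- (t * y)) + (s * w + y * q) * + 1)
                          - (s * w + y * (q - + 1))
                        ≡ (t * s - + 1) * (- y)
  PAQ-b = solve-∀
  PAQ-c : ∀ t w q → (+ 0 * + 1 + + 1 * + 0) * t + (+ 0 * w + + 1 * q) * + 0 ≡ + 0
  PAQ-c = solve-∀
  PAQ-d : ∀ t y w q → (+ 0 * + 1 + + 1 * + 0) * (- (t * y)) + (+ 0 * w + + 1 * q) * + 1 ≡ q
  PAQ-d = solve-∀

coprime-* : ∀ {a b c} → Coprime a c → Coprime b c → Coprime (a ℕ.* b) c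
coprime-* {a} {b} {c} a⊥c b⊥c {d} (d∣ab , d∣c) = a⊥c (d∣a , d∣c)
  where
  d⊥b : Coprime d b
  d⊥b (e∣d , e∣b) = b⊥c (e∣b , ℕ∣.∣-trans e∣d d∣c)
  d∣a : d ∣ a
  d∣a = coprime-divisor d⊥b (subst (d ∣_) (ℕ.*-comm a b) d∣ab)

prime-coprime : ∀ {ℓ m} → Prime ℓ → ¬ (ℓ ∣ m) → Coprime ℓ m
prime-coprime pℓ ℓ∤m (d∣ℓ , d∣m) with prime⇒irreducible pℓ d∣ℓ
... | inj₁ d≡1    = d≡1
... | inj₂ refl   = ⊥-elim (ℓ∤m d∣m)

prime-power-coprime : ∀ {ℓ m} n → Prime ℓ → ¬ (ℓ ∣ m) → Coprime (ℓ ^ n) m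
prime-power-coprime zero    _  _   (d∣1 , _) = ℕ∣.∣1⇒≡1 d∣1
prime-power-coprime (suc n) pℓ ℓ∤m =
  coprime-* (prime-coprime pℓ ℓ∤m) (prime-power-coprime n pℓ ℓ∤m)

embed : ∀ a b c d e → a ℕ.+ b ℕ.* c ≡ d ℕ.* e → + a + + b * + c ≡ + d * + e
embed a b c d e eq = begin
  + a + + b * + c        ≡⟨ cong (λ z → + a + z) (ℤ.pos-* b c) ⟨
  + a + + (b ℕ.* c)      ≡⟨ ℤ.pos-+ a (b ℕ.* c) ⟨
  + (a ℕ.+ b ℕ.* c)      ≡⟨ cong +_ eq ⟩
  + (d ℕ.* e)            ≡⟨ ℤ.pos-* d e ⟩
  + d * + e              ∎
  where open ≡-Reasoning

nat-unit : ∀ {N K} → Coprime N K → Σ ℤ λ t → + K * t ≈ + 1 [mod N ]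
nat-unit {N} {K} N⊥K with coprime-Bézout N⊥K
... | Bézout.+- x y eq = - + y , ≈-intro (divides (- + x) (begin
      + K * - + y - + 1          ≡⟨ negate-affine (+ K) (+ y) ⟩
      - (+ 1 + + y * + K)        ≡⟨ cong -_ (embed 1 y K x N eq) ⟩
      - (+ x * + N)              ≡⟨ ℤ.neg-distribˡ-* (+ x) (+ N) ⟩
      - + x * + N                ∎))
  where
  open ≡-Reasoning
  negate-affine : ∀ k y → k * - y - + 1 ≡ - (+ 1 + y * k)
  negate-affine = solve-∀
... | Bézout.-+ x y eq = + y , ≈-intro (divides (+ x) (begin
      + K * + y - + 1            ≡⟨ cong (_- + 1) (ℤ.*-comm (+ K) (+ y)) ⟩
      + y * + K - + 1            ≡⟨ cong (_- + 1) (embed 1 x N y K eq) ⟨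
      + 1 + + x * + N - + 1      ≡⟨ cancel (+ x * + N) ⟩
      + x * + N                  ∎))
  where
  open ≡-Reasoning
  cancel : ∀ z → + 1 + z - + 1 ≡ z
  cancel = solve-∀

prime-power-unit : ∀ {ℓ} n k → Prime ℓ → ¬ (+ ℓ ∣ℤ k) → Σ ℤ λ t → k * t ≈ + 1 [mod ℓ ^ n ]
prime-power-unit {ℓ} n k pℓ ℓ∤k with nat-unit (prime-power-coprime n pℓ ℓ∤∣k∣)
  where
  ℓ∤∣k∣ : ¬ (ℓ ∣ ∣ k ∣)
  ℓ∤∣k∣ ℓ∣∣k∣ = ℓ∤k (ℤ∣.∣ᵤ⇒∣ ℓ∣∣k∣)
prime-power-unit n (+ m)     _ _ | t , mt≈1 = t , mt≈1
prime-power-unit n -[1+ m ]  _ _ | t , mt≈1 = - t , ≈-trans (≈-reflexive (negate² (+ suc m) t)) mt≈1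
  where
  negate² : ∀ x y → (- x) * (- y) ≡ x * y
  negate² = solve-∀

^-monoʳ-∣ : ∀ x {m n} → m ≤ n → x ^ m ∣ x ^ n
^-monoʳ-∣ x {m} {n} m≤n = ℕ∣.divides (x ^ (n ∸ m)) (begin
  x ^ n                  ≡⟨ cong (x ^_) (ℕ.m+[n∸m]≡n m≤n) ⟨
  x ^ (m ℕ.+ (n ∸ m))    ≡⟨ ℕ.^-distribˡ-+-* x m (n ∸ m) ⟩
  x ^ m ℕ.* x ^ (n ∸ m)  ≡⟨ ℕ.*-comm (x ^ m) (x ^ (n ∸ m)) ⟩
  x ^ (n ∸ m) ℕ.* x ^ m  ∎)
  where open ≡-Reasoning

^-cancelʳ-∣ : ∀ {x} → 1 < x → ∀ {m n} → x ^ m ∣ x ^ n → m ≤ n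
^-cancelʳ-∣ {x@(suc _)} 1<x {m} {n} xᵐ∣xⁿ with m ℕ.≤? n
... | yes m≤n = m≤n
... | no  m≰n = ⊥-elim (ℕ.<⇒≱ (ℕ.^-monoʳ-< x 1<x (ℕ.≰⇒> m≰n))
                               (ℕ∣.∣⇒≤ {{ℕ.m^n≢0 x n}} xᵐ∣xⁿ))

∣⇒≈0 : ∀ {D x} → D ∣ x → + x ≈ + 0 [mod D ]
∣⇒≈0 {D} {x} D∣x = ≈-intro (subst (+ D ∣ℤ_) (sym (ℤ.+-identityʳ (+ x))) (ℤ∣.∣ᵤ⇒∣ D∣x))

≈0⇒∣ : ∀ {D x} → + x ≈ + 0 [mod D ] → D ∣ x
≈0⇒∣ {D} {x} (≈-intro D∣x-0) = ℤ∣.∣⇒∣ᵤ (subst (+ D ∣ℤ_) (ℤ.+-identityʳ (+ x)) D∣x-0)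

M≈I : ∀ {ℓ q′ ν c α} → ℓ ^ ν ∣ q′ → c ≤ α → c ≤ ν → M ℓ (suc q′) α ≈ₘ I₂ [mod ℓ ^ c ]
M≈I {ℓ} ℓᵛ∣q′ c≤α c≤ν =
  ≈ₘ-intro ≈-refl (∣⇒≈0 (^-monoʳ-∣ ℓ c≤α)) ≈-refl
           (≈-intro (ℤ∣.∣ᵤ⇒∣ (ℕ∣.∣-trans (^-monoʳ-∣ ℓ c≤ν) ℓᵛ∣q′)))

M≈I⇒≤ : ∀ {ℓ q c α} → 1 < ℓ → M ℓ q α ≈ₘ I₂ [mod ℓ ^ c ] → c ≤ α
M≈I⇒≤ 1<ℓ M≈I = ^-cancelʳ-∣ 1<ℓ (≈0⇒∣ (b≈ M≈I))

-- Powers of ℓ agree modulo ℓ^n when their exponents bound the same c ≤ n,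
-- i.e. when min(n,α) = min(n,β).
^-≈ : ∀ ℓ n α β → (∀ {c} → c ≤ n → c ≤ α → c ≤ β) → (∀ {c} → c ≤ n → c ≤ β → c ≤ α)
    → + (ℓ ^ α) ≈ + (ℓ ^ β) [mod ℓ ^ n ]
^-≈ ℓ n α β α⇒β β⇒α with n ℕ.≤? α | n ℕ.≤? β
... | yes n≤α | _       = ≈-trans (∣⇒≈0 (^-monoʳ-∣ ℓ n≤α))
                                  (≈-sym (∣⇒≈0 (^-monoʳ-∣ ℓ (α⇒β ℕ.≤-refl n≤α))))
... | no  n≰α | yes n≤β = ⊥-elim (n≰α (β⇒α ℕ.≤-refl n≤β))
... | no  n≰α | no  n≰β = ≈-reflexive (cong (λ e → + (ℓ ^ e))
                            (ℕ.≤-antisym (α⇒β (below n≰α) ℕ.≤-refl) (β⇒α (below n≰β) ℕ.≤-refl)))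
  where
  below : ∀ {m} → ¬ (n ≤ m) → m ≤ n
  below n≰m = ℕ.<⇒≤ (ℕ.≰⇒> n≰m)

exponent-transfer : ∀ {ℓ q′ n ν w α β} → 1 < ℓ → ℓ ^ ν ∣ q′ → α ≤ ν
  → Conj (ℓ ^ n) (Up w (suc q′)) (M ℓ (suc q′) α)
  → Conj (ℓ ^ n) (Up w (suc q′)) (M ℓ (suc q′) β)
  → ∀ {c} → c ≤ n → c ≤ α → c ≤ β
exponent-transfer {ℓ} {q′} {n} {α = α} 1<ℓ ℓᵛ∣q′ α≤ν Cα Cβ {c} c≤n c≤α =
  M≈I⇒≤ 1<ℓ (≡I-invariant ℓᶜ∣ℓⁿ Cβ (≡I-invariant ℓᶜ∣ℓⁿ (Conj-sym Cα) Mα≈I))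
  where
  ℓᶜ∣ℓⁿ : ℓ ^ c ∣ ℓ ^ n
  ℓᶜ∣ℓⁿ = ^-monoʳ-∣ ℓ c≤n
  Mα≈I : M ℓ (suc q′) α ≈ₘ I₂ [mod ℓ ^ c ]
  Mα≈I = M≈I ℓᵛ∣q′ c≤α (ℕ.≤-trans c≤α α≤ν)

maximal-below : ∀ {P : ℕ → Set} → (∀ a → Dec (P a)) → P 0 → ∀ ν
              → Σ ℕ λ a → a ≤ ν × P a × (a ≡ ν ⊎ ¬ P (suc a))
maximal-below {P} P? P0 ν = scan ν ℕ.≤-refl (inj₁ refl)
  where
  scan : ∀ c → c ≤ ν → c ≡ ν ⊎ ¬ P (suc c) → Σ ℕ λ a → a ≤ ν × P a × (a ≡ ν ⊎ ¬ P (suc a))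
  scan zero    c≤ν maximal = zero , c≤ν , P0 , maximal
  scan (suc c) c≤ν maximal with P? (suc c)
  ... | yes Pc = suc c , c≤ν , Pc , maximal
  ... | no ¬Pc = scan c (ℕ.≤-trans (ℕ.n≤1+n c) c≤ν) (inj₂ ¬Pc)

cofactor-indivisible : ∀ {ℓ a k x} → ¬ (+ (ℓ ^ suc a) ∣ℤ x) → x ≡ k * + (ℓ ^ a) → ¬ (+ ℓ ∣ℤ k)
cofactor-indivisible {ℓ} {a} ℓᵃ⁺¹∤x x≡kℓᵃ ℓ∣k =
  ℓᵃ⁺¹∤x (subst₂ _∣ℤ_ (sym (ℤ.pos-* ℓ (ℓ ^ a))) (sym x≡kℓᵃ) (ℤ∣.*-monoˡ-∣ (+ (ℓ ^ a)) ℓ∣k))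

rescale-to-M : ∀ {ℓ n a} q k w → Prime ℓ → ¬ (+ ℓ ∣ℤ k) → w ≡ k * + (ℓ ^ a)
             → Conj (ℓ ^ n) (Up w q) (M ℓ q a)
rescale-to-M {ℓ} {n} {a} q k w pℓ ℓ∤k w≡kℓᵃ with prime-power-unit n k pℓ ℓ∤k
... | t , kt≈1 = Conj-respʳ (triangular-conj t k (+ 0) w q kt≈1)
                            (Up-cong (≈-multiple (+ (ℓ ^ a)) twist kt≈1))
  where
  rescaled : ∀ t k p z → t * (k * p) + + 0 * z - p ≡ (k * t - + 1) * p
  rescaled = solve-∀
  twist : t * w + + 0 * (+ q - + 1) - + (ℓ ^ a) ≡ (k * t - + 1) * + (ℓ ^ a)
  twist = trans (cong (λ x → t * x + + 0 * (+ q - + 1) - + (ℓ ^ a)) w≡kℓᵃ)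
                (rescaled t k (+ (ℓ ^ a)) (+ q - + 1))

shear-to-M : ∀ {ℓ n ν q′} k u w → Prime ℓ → ¬ (+ ℓ ∣ℤ u) → w ≡ k * + (ℓ ^ ν)
           → + q′ ≡ u * + (ℓ ^ ν) → Conj (ℓ ^ n) (Up w (suc q′)) (M ℓ (suc q′) ν)
shear-to-M {ℓ} {n} {ν} {q′} k u w pℓ ℓ∤u w≡kℓᵛ q′≡uℓᵛ with prime-power-unit n u pℓ ℓ∤u
... | u′ , uu′≈1 = Conj-respʳ (triangular-conj (+ 1) (+ 1) y w (suc q′) ≈-refl)
                              (Up-cong (≈-multiple ((+ 1 - k) * + (ℓ ^ ν)) sheared uu′≈1))
  where
  y : ℤ
  y = u′ * (+ 1 - k)
  cancel : ∀ k u u′ p → + 1 * (k * p) + u′ * (+ 1 - k) * (u * p) - p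
                        ≡ (u * u′ - + 1) * ((+ 1 - k) * p)
  cancel = solve-∀
  sheared : + 1 * w + y * + q′ - + (ℓ ^ ν) ≡ (u * u′ - + 1) * ((+ 1 - k) * + (ℓ ^ ν))
  sheared = trans (cong₂ (λ x z → + 1 * x + y * z - + (ℓ ^ ν)) w≡kℓᵛ q′≡uℓᵛ)
                  (cancel k u u′ (+ (ℓ ^ ν)))

existence : ∀ {ℓ n ν q′} w → Prime ℓ → ℓ ^ ν ∣ q′ → ¬ (ℓ ^ suc ν ∣ q′)
          → Σ ℕ λ α → α ≤ ν × Conj (ℓ ^ n) (Up w (suc q′)) (M ℓ (suc q′) α)
existence {ℓ} {n} {ν} {q′} w pℓ (ℕ∣.divides u q′≡uℓᵛ) ℓᵛ⁺¹∤q′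
  with maximal-below (λ a → + (ℓ ^ a) ℤ∣.∣? w) (ℤ∣.∣ᵤ⇒∣ (ℕ∣.1∣ ∣ w ∣)) ν
... | a , a≤ν , divides k w≡kℓᵃ , inj₂ ℓᵃ⁺¹∤w =
  a , a≤ν , rescale-to-M {n = n} {a} (suc q′) k w pℓ
                          (cofactor-indivisible {a = a} ℓᵃ⁺¹∤w w≡kℓᵃ) w≡kℓᵃ
... | a , a≤ν , divides k w≡kℓᵛ , inj₁ refl =
  ν , a≤ν , shear-to-M {n = n} {ν} k (+ u) w pℓ
                        (cofactor-indivisible {a = ν} ℓᵛ⁺¹∤+q′ +q′≡uℓᵛ) w≡kℓᵛ +q′≡uℓᵛ
  where
  +q′≡uℓᵛ : + q′ ≡ + u * + (ℓ ^ ν)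
  +q′≡uℓᵛ = trans (cong +_ q′≡uℓᵛ) (ℤ.pos-* u (ℓ ^ ν))
  ℓᵛ⁺¹∤+q′ : ¬ (+ (ℓ ^ suc ν) ∣ℤ + q′)
  ℓᵛ⁺¹∤+q′ ℓᵛ⁺¹∣q′ = ℓᵛ⁺¹∤q′ (ℤ∣.∣⇒∣ᵤ ℓᵛ⁺¹∣q′)

uniqueness : ∀ {ℓ n ν q′ w α β} → 1 < ℓ → ℓ ^ ν ∣ q′ → α ≤ ν → β ≤ ν
           → Conj (ℓ ^ n) (Up w (suc q′)) (M ℓ (suc q′) α)
           → Conj (ℓ ^ n) (Up w (suc q′)) (M ℓ (suc q′) β)
           → M ℓ (suc q′) α ≈ₘ M ℓ (suc q′) β [mod ℓ ^ n ]
uniqueness {ℓ} {n} {α = α} {β} 1<ℓ ℓᵛ∣q′ α≤ν β≤ν Cα Cβ =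
  Up-cong (^-≈ ℓ n α β (exponent-transfer 1<ℓ ℓᵛ∣q′ α≤ν Cα Cβ)
                       (exponent-transfer 1<ℓ ℓᵛ∣q′ β≤ν Cβ Cα))

lemma15 : (q ℓ n ν : ℕ) → IsPrimePower q → Prime ℓ → ¬ (ℓ ∣ q) → n ≥ 1
    → IsValuation ℓ (q ∸ 1) ν
    → (w : ℤ)
    → (Σ ℕ λ α → α ≤ ν × Conj (ℓ ^ n) (Up w q) (M ℓ q α))
      × ((α β : ℕ) → α ≤ ν → β ≤ ν
         → Conj (ℓ ^ n) (Up w q) (M ℓ q α) → Conj (ℓ ^ n) (Up w q) (M ℓ q β)
         → M ℓ q α ≅[mod ℓ ^ n ] M ℓ q β)
lemma15 zero     ℓ n ν _ _  ℓ∤q _ _ _ = ⊥-elim (ℓ∤q (ℓ ℕ∣.∣0))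
lemma15 (suc q′) ℓ n ν _ pℓ _   _ (ℓᵛ∣q′ , ℓᵛ⁺¹∤q′) w =
  existence {n = n} w pℓ ℓᵛ∣q′ ℓᵛ⁺¹∤q′ ,
  λ α β α≤ν β≤ν Cα Cβ → toCong (uniqueness {n = n} 1<ℓ ℓᵛ∣q′ α≤ν β≤ν Cα Cβ)
  where
  1<ℓ : 1 < ℓ
  1<ℓ = nonTrivial⇒n>1 ℓ {{prime⇒nonTrivial pℓ}}
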